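{- Let $k$ be a positive integer that is not a perfect square, let $d$ be one of the two integers nearest to $\sqrt{k}$ (that is, $d=\lfloor\sqrt{k}\rfloor$ or $d=\lceil\sqrt{k}\rceil$), and let $f(x)=\dfrac{dx+k}{x+d}$. If $R=\dfrac{4d^2}{k-d^2}$ is an integer, then every iterate $f^n(\infty)$, $n\ge1$, is a semiconvergent of the continued fraction expansion of $\sqrt{k}$.
   Context: $f$ acts on $\mathbb{R}\cup\{\infty\}$ with $f(\infty)=d$, and $f^n$ is its $n$-fold composite. If $\sqrt{k}=[c_0;c_1,c_2,\dots]$ is the simple continued fraction expansion, a semiconvergent is a rational number of the form $[c_0;c_1,\dots,c_{n-1},b]$ with $n\ge0$ and $b$ an integer with $0\le b\le c_n$. -}

module Defs where

open import Data.Nat using (ℕ; zero; suc; _+_; _*_; _∸_; _≤_; _<_; _/_)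
open import Data.Nat.Properties using (_≤?_)
open import Data.Bool using (if_then_else_)
open import Relation.Nullary.Decidable using (⌊_⌋)
open import Data.Product using (_×_; _,_; proj₁; proj₂)
open import Relation.Binary.PropositionalEquality using (_≡_)
open import Data.List using (List; []; _∷_; _++_; map; upTo)

-- Total natural-number division (x div' 0 = 0); only ever used with a
-- nonzero divisor in the continued-fraction algorithm below.
_div'_ : ℕ → ℕ → ℕ
x div' zero  = zero
x div' suc n = x / suc n

fsqrtAux : ℕ → ℕ → ℕ
fsqrtAux zero    k = zero
fsqrtAux (suc b) k = if ⌊ suc b * suc b ≤? k ⌋ then suc b else fsqrtAux b k

fsqrt : ℕ → ℕ
fsqrt k = fsqrtAux k k

-- Simple continued fraction expansion √k = [c₀; c₁, c₂, …] for non-square k,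
-- via the standard complete-quotient algorithm: the n-th complete quotient is
-- x_n = (m_n + √k) / q_n, with (m₀ , q₀) = (0 , 1),
-- c_n = ⌊x_n⌋ = ⌊(m_n + ⌊√k⌋) / q_n⌋,
-- m_{n+1} = c_n q_n − m_n,  q_{n+1} = (k − m_{n+1}²) / q_n.
cfState : ℕ → ℕ → ℕ × ℕ
cfState k zero    = 0 , 1
cfState k (suc n) =
  let m  = proj₁ (cfState k n)
      q  = proj₂ (cfState k n)
      a  = (fsqrt k + m) div' q
      m' = a * q ∸ m
  in m' , (k ∸ m' * m') div' q

cf : ℕ → ℕ → ℕ
cf k n = (fsqrt k + proj₁ (cfState k n)) div' proj₂ (cfState k n)

-- Value of a finite continued fraction [a₀; a₁, …, a_r] as a point p/q of the
-- projective line ℚ ∪ {∞} (q = 0 means ∞), using x ↦ a + 1/x on pairs: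
-- [] ↦ ∞ = 1/0, and (a ∷ as) ↦ a + 1/[as].  This handles a final entry 0
-- exactly as the convention 1/0 = ∞, 1/∞ = 0.
cfValue : List ℕ → ℕ × ℕ
cfValue []       = 1 , 0
cfValue (a ∷ as) = a * proj₁ (cfValue as) + proj₂ (cfValue as) , proj₁ (cfValue as)

semiconvList : ℕ → ℕ → ℕ → List ℕ
semiconvList k n b = map (cf k) (upTo n) ++ (b ∷ [])

-- f(x) = (d x + k)/(x + d) acting on ℝ ∪ {∞} (f(∞) = d); on projective
-- coordinates p/q it is (p , q) ↦ (d p + k q , p + d q).
fPair : ℕ → ℕ → ℕ × ℕ → ℕ × ℕ
fPair k d (p , q) = d * p + k * q , p + d * q

iter : ℕ → ℕ → ℕ → ℕ × ℕ
iter k d zero    = 1 , 0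
iter k d (suc n) = fPair k d (iter k d n)

_≈P_ : ℕ × ℕ → ℕ × ℕ → Set
(p , q) ≈P (p' , q') = p * q' ≡ p' * q

-- The norm N(x, y) = x² − k y² is multiplied by δ = d² − k under (x , y) ↦ (d x + k y , x + d y).
-- Integrality of R = 4d²/(k − d²) means |δ| ∣ (2d)², so |δ| = αβ with α, β ∣ 2d, and then the
-- iterates stay divisible alternately by α and by β: removing these factors, f^n(∞) = x/y with
-- N(x, y) ∈ {δ, β²}, both at most 2⌊√k⌋ in absolute value.  Such an x/y is so close to √k that no
-- fraction of denominator at most y lies strictly between x/y and √k (Legendre's argument), and
-- descending the Stern–Brocot tree towards √k, whose mediants are exactly the semiconvergents
-- produced by the complete-quotient algorithm, must therefore meet x/y.
module Submission where

open import Defs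
open import Data.Empty using (⊥; ⊥-elim)
open import Data.Integer using (ℤ; +_; _-_; -[1+_])
  renaming (∣_∣ to abs; _+_ to _+ℤ_; _*_ to _*ℤ_; -_ to -ℤ_)
import Data.Integer as ℤ using (NonZero; >-nonZero; +<+)
import Data.Integer.Divisibility.Signed as ℤ∣
import Data.Integer.Properties as ℤₚ
import Data.Integer.Tactic.RingSolver as ℤ-Ring
open import Data.List using (List; []; _∷_; _++_; map; upTo)
open import Data.List.Properties using (map-++; upTo-∷ʳ; ++-assoc)
open import Data.Nat
  using (ℕ; zero; suc; _+_; _*_; _∸_; _/_; _%_; _≤_; _<_; z≤n; s≤s; NonZero; >-nonZero; ≢-nonZero)
open import Data.Nat.Coprimality using (coprime-/gcd; coprime-divisor)
open import Data.Nat.Divisibility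
  using (_∣_; divides; quotient; m∣n⇒n≡quotient*m; ∣-refl; ∣⇒≤; n∣m*n; m∣m*n; m/n∣m; *-pres-∣; *-cancelˡ-∣)
open import Data.Nat.DivMod
  using (m/n*n≤m; m≡m%n+[m/n]*n; m%n<n; m*n/n≡m; m/n*n≡m; m*[n/m]≡n; m≥n⇒m/n>0)
open import Data.Nat.GCD using (gcd; gcd[m,n]∣m; gcd[m,n]∣n; gcd[m,n]≢0; gcd-greatest)
open import Data.Nat.Properties
open import Data.Nat.Tactic.RingSolver using (solve-∀)
open import Data.Product using (_×_; _,_; proj₁; proj₂; ∃-syntax)
open import Data.Sum using (_⊎_; inj₁; inj₂; [_,_]′)
open import Relation.Binary.Definitions using (tri<; tri≈; tri>)
open import Relation.Binary.PropositionalEquality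
  using (_≡_; refl; sym; trans; cong; cong₂; subst; subst₂; module ≡-Reasoning)
open import Relation.Nullary using (¬_; yes; no)

fsqrtAux-sq≤ : ∀ b k → fsqrtAux b k * fsqrtAux b k ≤ k
fsqrtAux-sq≤ zero    k = z≤n
fsqrtAux-sq≤ (suc b) k with suc b * suc b ≤? k
... | yes b²≤k = b²≤k
... | no  _    = fsqrtAux-sq≤ b k

fsqrtAux-greatest : ∀ b k a → a ≤ b → a * a ≤ k → a ≤ fsqrtAux b k
fsqrtAux-greatest zero    k .zero z≤n _ = z≤n
fsqrtAux-greatest (suc b) k a a≤b a²≤k with suc b * suc b ≤? k
... | yes _ = a≤b
... | no b²≰k with m≤n⇒m<n∨m≡n a≤b
...   | inj₁ a<b  = fsqrtAux-greatest b k a (≤-pred a<b) a²≤k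
...   | inj₂ refl = ⊥-elim (b²≰k a²≤k)

n≤n*n : ∀ n → n ≤ n * n
n≤n*n zero    = z≤n
n≤n*n (suc n) = m≤m*n (suc n) (suc n)

fsqrt-sq≤ : ∀ k → fsqrt k * fsqrt k ≤ k
fsqrt-sq≤ k = fsqrtAux-sq≤ k k

fsqrt-greatest : ∀ {k a} → a * a ≤ k → a ≤ fsqrt k
fsqrt-greatest {k} {a} a²≤k = fsqrtAux-greatest k k a (≤-trans (n≤n*n a) a²≤k) a²≤k

<-suc-fsqrt-sq : ∀ k → k < suc (fsqrt k) * suc (fsqrt k)
<-suc-fsqrt-sq k = ≰⇒> (λ le → <-irrefl refl (fsqrt-greatest le))

m*m<n*n⇒m<n : ∀ {m n} → m * m < n * n → m < n
m*m<n*n⇒m<n m²<n² = ≰⇒> (λ n≤m → <⇒≱ m²<n² (*-mono-≤ n≤m n≤m))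

m*m≤n*n⇒m≤n : ∀ {m n} → m * m ≤ n * n → m ≤ n
m*m≤n*n⇒m≤n m²≤n² = ≮⇒≥ (λ n<m → <⇒≱ (*-mono-< n<m n<m) m²≤n²)

*-pos⇒posˡ : ∀ {m n} → 1 ≤ m * n → 1 ≤ m
*-pos⇒posˡ {suc m} _ = s≤s z≤n

≈P-scale : ∀ a {x y} → (a * x , a * y) ≈P (x , y)
≈P-scale a {x} {y} = reassoc a x y
  where
  reassoc : ∀ a x y → a * x * y ≡ x * (a * y)
  reassoc = solve-∀

≈P-trans : ∀ {u v w} → 1 ≤ proj₂ v → u ≈P v → v ≈P w → u ≈P w
≈P-trans {p , q} {p′ , q′@(suc _)} {p″ , q″} _ uv vw = *-cancelʳ-≡ (p * q″) (p″ * q) q′ (begin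
  p * q″ * q′  ≡⟨ swap p q″ q′ ⟩
  p * q′ * q″  ≡⟨ cong (_* q″) uv ⟩
  p′ * q * q″  ≡⟨ swap p′ q q″ ⟩
  p′ * q″ * q  ≡⟨ cong (_* q) vw ⟩
  p″ * q′ * q  ≡⟨ swap p″ q′ q ⟩
  p″ * q * q′  ∎)
  where
  open ≡-Reasoning
  swap : ∀ a b c → a * b * c ≡ a * c * b
  swap = solve-∀

fPair-cong : ∀ k d {u v} → u ≈P v → fPair k d u ≈P fPair k d v
fPair-cong k d {p , q} {p′ , q′} pq′≡p′q = begin
  (d * p + k * q) * (p′ + d * q′)           ≡⟨ expand k d p q p′ q′ ⟩
  common + d * d * (p * q′) + k * (p′ * q)
    ≡⟨ cong₂ (λ u v → common + d * d * u + k * v) pq′≡p′q (sym pq′≡p′q) ⟩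
  common + d * d * (p′ * q) + k * (p * q′)  ≡⟨ regroup k d p q p′ q′ ⟩
  (d * p′ + k * q′) * (p + d * q)           ∎
  where
  open ≡-Reasoning
  common = d * p * p′ + d * k * q * q′
  expand : ∀ k d p q p′ q′ →
    (d * p + k * q) * (p′ + d * q′) ≡ d * p * p′ + d * k * q * q′ + d * d * (p * q′) + k * (p′ * q)
  expand = solve-∀
  regroup : ∀ k d p q p′ q′ →
    d * p * p′ + d * k * q * q′ + d * d * (p′ * q) + k * (p * q′) ≡ (d * p′ + k * q′) * (p + d * q)
  regroup = solve-∀

-- (m + √k)/Q is a reduced complete quotient of √k, s = ⌊√k⌋, and Q⁻ the denominator before Q
record Reduced (s k Q m Q⁻ : ℕ) : Set where
  constructor reduced
  field
    Q≥1    : 1 ≤ Q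
    m≤s    : m ≤ s
    Q≤s+m  : Q ≤ s + m
    Q⁻Q+m² : Q⁻ * Q + m * m ≡ k

next-denominator : ∀ {k Q m Q⁻ c m′} .{{_ : NonZero Q}} →
  Q⁻ * Q + m * m ≡ k → m′ + m ≡ c * Q → m′ * m′ ≤ k →
  Q * ((k ∸ m′ * m′) / Q) + m′ * m′ ≡ k × (k ∸ m′ * m′) / Q + c * (c * Q) ≡ Q⁻ + c * (2 * m)
next-denominator {k} {Q} {m} {Q⁻} {c} {m′} Q⁻Q+m²≡k m′+m≡cQ m′²≤k =
  trans (cong (λ z → Q * z + m′ * m′) W/Q≡X∸Y) (trans (cong (_+ m′ * m′) QZ≡W) W+m′²≡k) ,
  trans (cong (_+ Y) W/Q≡X∸Y) (m∸n+n≡m Y≤X)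
  where
  open ≡-Reasoning
  W = k ∸ m′ * m′
  X = Q⁻ + c * (2 * m)
  Y = c * (c * Q)
  W+m′²≡k : W + m′ * m′ ≡ k
  W+m′²≡k = m∸n+n≡m m′²≤k
  QX≡W+QY : Q * X ≡ W + Q * Y
  QX≡W+QY = +-cancelʳ-≡ (m * m) _ _ (begin
    Q * X + m * m                       ≡⟨ expand Q Q⁻ c m ⟩
    (Q⁻ * Q + m * m) + 2 * m * (c * Q)  ≡⟨ cong₂ _+_ Q⁻Q+m²≡k (cong (2 * m *_) (sym m′+m≡cQ)) ⟩
    k + 2 * m * (m′ + m)                ≡⟨ cong (_+ 2 * m * (m′ + m)) W+m′²≡k ⟨
    (W + m′ * m′) + 2 * m * (m′ + m)    ≡⟨ square-sum W m′ m ⟩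
    W + (m′ + m) * (m′ + m) + m * m     ≡⟨ cong (λ z → W + z * z + m * m) m′+m≡cQ ⟩
    W + (c * Q) * (c * Q) + m * m       ≡⟨ regroup W Q c m ⟩
    (W + Q * Y) + m * m                 ∎)
    where
    expand : ∀ Q Q⁻ c m → Q * (Q⁻ + c * (2 * m)) + m * m ≡ (Q⁻ * Q + m * m) + 2 * m * (c * Q)
    expand = solve-∀
    square-sum : ∀ W m′ m → W + m′ * m′ + 2 * m * (m′ + m) ≡ W + (m′ + m) * (m′ + m) + m * m
    square-sum = solve-∀
    regroup : ∀ W Q c m → W + (c * Q) * (c * Q) + m * m ≡ (W + Q * (c * (c * Q))) + m * m
    regroup = solve-∀
  Y≤X : Y ≤ X
  Y≤X = *-cancelˡ-≤ Q (subst (Q * Y ≤_) (sym QX≡W+QY) (m≤n+m (Q * Y) W))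
  QZ≡W : Q * (X ∸ Y) ≡ W
  QZ≡W = begin
    Q * (X ∸ Y)        ≡⟨ *-distribˡ-∸ Q X Y ⟩
    Q * X ∸ Q * Y      ≡⟨ cong (_∸ Q * Y) QX≡W+QY ⟩
    W + Q * Y ∸ Q * Y  ≡⟨ m+n∸n≡m W (Q * Y) ⟩
    W                  ∎
  W/Q≡X∸Y : W / Q ≡ X ∸ Y
  W/Q≡X∸Y = trans (cong (_/ Q) (trans (sym QZ≡W) (*-comm Q (X ∸ Y)))) (m*n/n≡m (X ∸ Y) Q)

-- with a = s + 1 ∸ m′ ≤ Q:  Q Q′ = k − m′² < (s + 1)² − m′² = a (a + 2m′) ≤ Q (s + 1 + m′)
next-denominator-bound : ∀ {s k Q Q′ m′} → k < suc s * suc s → Q * Q′ + m′ * m′ ≡ k →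
  m′ ≤ s → s < m′ + Q → Q′ ≤ s + m′
next-denominator-bound {s} {k} {Q} {Q′} {m′} k<[1+s]² QQ′+m′²≡k m′≤s s<m′+Q =
  ≤-pred (*-cancelˡ-< Q Q′ (suc (s + m′)) QQ′<Q[1+s+m′])
  where
  a = suc s ∸ m′
  a+m′≡1+s : a + m′ ≡ suc s
  a+m′≡1+s = m∸n+n≡m (≤-trans m′≤s (n≤1+n s))
  a≤Q : a ≤ Q
  a≤Q = +-cancelʳ-≤ m′ a Q (subst₂ _≤_ (sym a+m′≡1+s) (+-comm m′ Q) s<m′+Q)
  QQ′<Q[1+s+m′] : Q * Q′ < Q * suc (s + m′)
  QQ′<Q[1+s+m′] = +-cancelʳ-< (m′ * m′) (Q * Q′) (Q * suc (s + m′)) (begin-strict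
    Q * Q′ + m′ * m′             ≡⟨ QQ′+m′²≡k ⟩
    k                            <⟨ k<[1+s]² ⟩
    suc s * suc s                ≡⟨ cong (λ z → z * z) a+m′≡1+s ⟨
    (a + m′) * (a + m′)          ≡⟨ expand a m′ ⟩
    a * (a + m′ + m′) + m′ * m′  ≤⟨ +-monoˡ-≤ (m′ * m′) (*-monoˡ-≤ (a + m′ + m′) a≤Q) ⟩
    Q * (a + m′ + m′) + m′ * m′  ≡⟨ cong (λ z → Q * (z + m′) + m′ * m′) a+m′≡1+s ⟩
    Q * suc (s + m′) + m′ * m′   ∎)
    where
    open ≤-Reasoning
    expand : ∀ a m′ → (a + m′) * (a + m′) ≡ a * (a + m′ + m′) + m′ * m′
    expand = solve-∀

module _ {s k : ℕ} (s²<k : s * s < k) (k<[1+s]² : k < suc s * suc s) where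

  reduced-step : ∀ {Q m Q⁻} → Reduced s k Q m Q⁻ →
    let c = (s + m) div' Q ; m′ = c * Q ∸ m ; Q′ = (k ∸ m′ * m′) div' Q in
    m′ + m ≡ c * Q × 1 ≤ c × Reduced s k Q′ m′ Q × Q′ + c * (c * Q) ≡ Q⁻ + c * (2 * m)
  reduced-step {Q@(suc _)} {m} {Q⁻} (reduced _ m≤s Q≤s+m Q⁻Q+m²≡k) =
    m′+m≡cQ , c≥1 , reduced Q′≥1 m′≤s Q′≤s+m′ QQ′+m′²≡k , Q′-recurrence
    where
    c = (s + m) / Q
    m′ = c * Q ∸ m
    Q′ = (k ∸ m′ * m′) / Q
    cQ≤s+m : c * Q ≤ s + m
    cQ≤s+m = m/n*n≤m (s + m) Q
    s+m<cQ+Q : s + m < c * Q + Q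
    s+m<cQ+Q = begin-strict
      s + m                ≡⟨ m≡m%n+[m/n]*n (s + m) Q ⟩
      (s + m) % Q + c * Q  <⟨ +-monoˡ-< (c * Q) (m%n<n (s + m) Q) ⟩
      Q + c * Q            ≡⟨ +-comm Q (c * Q) ⟩
      c * Q + Q            ∎
      where open ≤-Reasoning
    c≥1 : 1 ≤ c
    c≥1 = m≥n⇒m/n>0 Q≤s+m
    -- if c Q < m then s < Q (from s + m < c Q + Q) and Q ≤ c Q < m ≤ s
    m≤cQ : m ≤ c * Q
    m≤cQ = ≮⇒≥ λ cQ<m →
      let Q≤cQ = subst (_≤ c * Q) (+-identityʳ Q) (*-monoˡ-≤ Q c≥1)
          s<Q  = +-cancelʳ-< m s Q (<-≤-trans s+m<cQ+Q
                   (≤-trans (+-monoˡ-≤ Q (<⇒≤ cQ<m)) (≤-reflexive (+-comm m Q))))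
      in <-irrefl refl (<-trans (<-≤-trans s<Q Q≤cQ) (<-≤-trans cQ<m m≤s))
    m′+m≡cQ : m′ + m ≡ c * Q
    m′+m≡cQ = m∸n+n≡m m≤cQ
    m′≤s : m′ ≤ s
    m′≤s = +-cancelʳ-≤ m m′ s (subst (_≤ s + m) (sym m′+m≡cQ) cQ≤s+m)
    m′²<k : m′ * m′ < k
    m′²<k = ≤-<-trans (*-mono-≤ m′≤s m′≤s) s²<k
    next = next-denominator {k} {Q} {m} {Q⁻} {c} {m′} Q⁻Q+m²≡k m′+m≡cQ (<⇒≤ m′²<k)
    QQ′+m′²≡k = proj₁ next
    Q′-recurrence = proj₂ next
    Q′≥1 : 1 ≤ Q′
    Q′≥1 = n≢0⇒n>0 λ Q′≡0 → <-irrefl (begin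
      m′ * m′           ≡⟨ cong (_+ m′ * m′) (*-zeroʳ Q) ⟨
      Q * 0 + m′ * m′   ≡⟨ cong (λ z → Q * z + m′ * m′) Q′≡0 ⟨
      Q * Q′ + m′ * m′  ≡⟨ QQ′+m′²≡k ⟩
      k                 ∎) m′²<k
      where open ≡-Reasoning
    s<m′+Q : s < m′ + Q
    s<m′+Q = +-cancelʳ-< m s (m′ + Q) (begin-strict
      s + m       <⟨ s+m<cQ+Q ⟩
      c * Q + Q   ≡⟨ cong (_+ Q) m′+m≡cQ ⟨
      m′ + m + Q  ≡⟨ swap m′ m Q ⟩
      m′ + Q + m  ∎)
      where
      open ≤-Reasoning
      swap : ∀ a b c → a + b + c ≡ a + c + b
      swap = solve-∀
    Q′≤s+m′ : Q′ ≤ s + m′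
    Q′≤s+m′ = next-denominator-bound k<[1+s]² QQ′+m′²≡k m′≤s s<m′+Q

div'-*-≤ : ∀ x Q → 1 ≤ Q → (x div' Q) * Q ≤ x
div'-*-≤ x (suc Q) _ = m/n*n≤m x (suc Q)

-- Convergents and semiconvergents

record Frame : Set where
  constructor frame
  field
    p q p⁻ q⁻ : ℕ
open Frame

numer denom : Frame → ℕ → ℕ
numer F j = j * p F + p⁻ F
denom F j = j * q F + q⁻ F

semi : Frame → ℕ → ℕ × ℕ
semi F j = numer F j , denom F j

next : ℕ → Frame → Frame
next c F = frame (numer F c) (denom F c) (p F) (q F)

-- p/q and p⁻/q⁻ are the last two convergents and (m + √k)/Q the next complete quotient, Q Q⁻ = k − m²
record LatestAbove (k : ℕ) (F : Frame) (m Q Q⁻ : ℕ) : Set where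
  constructor latestAbove
  field
    det   : p F * q⁻ F ≡ p⁻ F * q F + 1
    norm  : p F * p F ≡ k * (q F * q F) + Q
    cross : p F * p⁻ F + m ≡ k * (q F * q⁻ F)
    norm⁻ : p⁻ F * p⁻ F + Q⁻ ≡ k * (q⁻ F * q⁻ F)

record LatestBelow (k : ℕ) (F : Frame) (m Q Q⁻ : ℕ) : Set where
  constructor latestBelow
  field
    det   : p⁻ F * q F ≡ p F * q⁻ F + 1
    norm  : p F * p F + Q ≡ k * (q F * q F)
    cross : p F * p⁻ F ≡ k * (q F * q⁻ F) + m
    norm⁻ : p⁻ F * p⁻ F ≡ k * (q⁻ F * q⁻ F) + Q⁻

above-numer-norm : ∀ {k F m Q Q⁻} → LatestAbove k F m Q Q⁻ → ∀ j →
  numer F j * numer F j + (Q⁻ + j * (2 * m)) ≡ k * (denom F j * denom F j) + j * (j * Q)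
above-numer-norm {k} {F} {m} {Q} {Q⁻} (latestAbove _ norm cross norm⁻) j = begin
  numer F j * numer F j + (Q⁻ + j * (2 * m))
    ≡⟨ expand j (p F) (p⁻ F) m Q⁻ ⟩
  j * j * (p F * p F) + 2 * j * (p F * p⁻ F + m) + (p⁻ F * p⁻ F + Q⁻)
    ≡⟨ cong₂ _+_ (cong₂ _+_ (cong (j * j *_) norm) (cong (2 * j *_) cross)) norm⁻ ⟩
  j * j * (k * (q F * q F) + Q) + 2 * j * (k * (q F * q⁻ F)) + k * (q⁻ F * q⁻ F)
    ≡⟨ collect j k (q F) (q⁻ F) Q ⟩
  k * (denom F j * denom F j) + j * (j * Q) ∎
  where
  open ≡-Reasoning
  expand : ∀ j p p⁻ m Q⁻ → (j * p + p⁻) * (j * p + p⁻) + (Q⁻ + j * (2 * m))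
         ≡ j * j * (p * p) + 2 * j * (p * p⁻ + m) + (p⁻ * p⁻ + Q⁻)
  expand = solve-∀
  collect : ∀ j k q q⁻ Q → j * j * (k * (q * q) + Q) + 2 * j * (k * (q * q⁻)) + k * (q⁻ * q⁻)
          ≡ k * ((j * q + q⁻) * (j * q + q⁻)) + j * (j * Q)
  collect = solve-∀

below-numer-norm : ∀ {k F m Q Q⁻} → LatestBelow k F m Q Q⁻ → ∀ j →
  numer F j * numer F j + j * (j * Q) ≡ k * (denom F j * denom F j) + (Q⁻ + j * (2 * m))
below-numer-norm {k} {F} {m} {Q} {Q⁻} (latestBelow _ norm cross norm⁻) j = begin
  numer F j * numer F j + j * (j * Q)
    ≡⟨ expand j (p F) (p⁻ F) Q ⟩
  j * j * (p F * p F + Q) + 2 * j * (p F * p⁻ F) + p⁻ F * p⁻ F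
    ≡⟨ cong₂ _+_ (cong₂ _+_ (cong (j * j *_) norm) (cong (2 * j *_) cross)) norm⁻ ⟩
  j * j * (k * (q F * q F)) + 2 * j * (k * (q F * q⁻ F) + m) + (k * (q⁻ F * q⁻ F) + Q⁻)
    ≡⟨ collect j k (q F) (q⁻ F) m Q⁻ ⟩
  k * (denom F j * denom F j) + (Q⁻ + j * (2 * m)) ∎
  where
  open ≡-Reasoning
  expand : ∀ j p p⁻ Q → (j * p + p⁻) * (j * p + p⁻) + j * (j * Q)
         ≡ j * j * (p * p + Q) + 2 * j * (p * p⁻) + p⁻ * p⁻
  expand = solve-∀
  collect : ∀ j k q q⁻ m Q⁻ →
    j * j * (k * (q * q)) + 2 * j * (k * (q * q⁻) + m) + (k * (q⁻ * q⁻) + Q⁻)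
          ≡ k * ((j * q + q⁻) * (j * q + q⁻)) + (Q⁻ + j * (2 * m))
  collect = solve-∀

above-det-step : ∀ j p p⁻ q q⁻ → p * q⁻ ≡ p⁻ * q + 1 → p * (j * q + q⁻) ≡ (j * p + p⁻) * q + 1
above-det-step j p p⁻ q q⁻ det = begin
  p * (j * q + q⁻)        ≡⟨ expand j p q q⁻ ⟩
  j * (p * q) + p * q⁻    ≡⟨ cong (_+_ (j * (p * q))) det ⟩
  j * (p * q) + (p⁻ * q + 1) ≡⟨ collect j p p⁻ q ⟩
  (j * p + p⁻) * q + 1    ∎
  where
  open ≡-Reasoning
  expand : ∀ j p q q⁻ → p * (j * q + q⁻) ≡ j * (p * q) + p * q⁻
  expand = solve-∀
  collect : ∀ j p p⁻ q → j * (p * q) + (p⁻ * q + 1) ≡ (j * p + p⁻) * q + 1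
  collect = solve-∀

below-det-step : ∀ j p p⁻ q q⁻ → p⁻ * q ≡ p * q⁻ + 1 → (j * p + p⁻) * q ≡ p * (j * q + q⁻) + 1
below-det-step j p p⁻ q q⁻ det = begin
  (j * p + p⁻) * q           ≡⟨ expand j p p⁻ q ⟩
  j * (p * q) + p⁻ * q       ≡⟨ cong (_+_ (j * (p * q))) det ⟩
  j * (p * q) + (p * q⁻ + 1) ≡⟨ collect j p q q⁻ ⟩
  p * (j * q + q⁻) + 1       ∎
  where
  open ≡-Reasoning
  expand : ∀ j p p⁻ q → (j * p + p⁻) * q ≡ j * (p * q) + p⁻ * q
  expand = solve-∀
  collect : ∀ j p q q⁻ → j * (p * q) + (p * q⁻ + 1) ≡ p * (j * q + q⁻) + 1
  collect = solve-∀

above⇒below : ∀ {k F m Q Q⁻ c m′ Q′} → LatestAbove k F m Q Q⁻ → m′ + m ≡ c * Q →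
  Q′ + c * (c * Q) ≡ Q⁻ + c * (2 * m) → LatestBelow k (next c F) m′ Q′ Q
above⇒below {k} {F} {m} {Q} {Q⁻} {c} {m′} {Q′} A@(latestAbove det norm cross _) m′+m≡cQ Q′-rec =
  latestBelow (above-det-step c (p F) (p⁻ F) (q F) (q⁻ F) det) norm′ cross′ norm
  where
  open ≡-Reasoning
  norm′ = +-cancelʳ-≡ (c * (c * Q)) _ _ (begin
    numer F c * numer F c + Q′ + c * (c * Q)    ≡⟨ +-assoc (numer F c * numer F c) Q′ (c * (c * Q)) ⟩
    numer F c * numer F c + (Q′ + c * (c * Q))  ≡⟨ cong (_+_ (numer F c * numer F c)) Q′-rec ⟩
    numer F c * numer F c + (Q⁻ + c * (2 * m))  ≡⟨ above-numer-norm A c ⟩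
    k * (denom F c * denom F c) + c * (c * Q)   ∎)
  cross′ = +-cancelʳ-≡ m _ _ (begin
    numer F c * p F + m                      ≡⟨ expand c (p F) (p⁻ F) m ⟩
    c * (p F * p F) + (p F * p⁻ F + m)       ≡⟨ cong₂ _+_ (cong (c *_) norm) cross ⟩
    c * (k * (q F * q F) + Q) + k * (q F * q⁻ F) ≡⟨ collect c k (q F) (q⁻ F) Q ⟩
    k * (denom F c * q F) + c * Q            ≡⟨ cong (_+_ (k * (denom F c * q F))) m′+m≡cQ ⟨
    k * (denom F c * q F) + (m′ + m)         ≡⟨ +-assoc (k * (denom F c * q F)) m′ m ⟨
    k * (denom F c * q F) + m′ + m           ∎)
    where
    expand : ∀ c p p⁻ x → (c * p + p⁻) * p + x ≡ c * (p * p) + (p * p⁻ + x)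
    expand = solve-∀
    collect : ∀ c k q q⁻ Q → c * (k * (q * q) + Q) + k * (q * q⁻) ≡ k * ((c * q + q⁻) * q) + c * Q
    collect = solve-∀

below⇒above : ∀ {k F m Q Q⁻ c m′ Q′} → LatestBelow k F m Q Q⁻ → m′ + m ≡ c * Q →
  Q′ + c * (c * Q) ≡ Q⁻ + c * (2 * m) → LatestAbove k (next c F) m′ Q′ Q
below⇒above {k} {F} {m} {Q} {Q⁻} {c} {m′} {Q′} B@(latestBelow det norm cross _) m′+m≡cQ Q′-rec =
  latestAbove (below-det-step c (p F) (p⁻ F) (q F) (q⁻ F) det) norm′ cross′ norm
  where
  open ≡-Reasoning
  norm′ = +-cancelʳ-≡ (c * (c * Q)) _ _ (begin
    numer F c * numer F c + c * (c * Q)              ≡⟨ below-numer-norm B c ⟩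
    k * (denom F c * denom F c) + (Q⁻ + c * (2 * m)) ≡⟨ cong (_+_ (k * (denom F c * denom F c))) Q′-rec ⟨
    k * (denom F c * denom F c) + (Q′ + c * (c * Q)) ≡⟨ +-assoc (k * (denom F c * denom F c)) Q′ (c * (c * Q)) ⟨
    k * (denom F c * denom F c) + Q′ + c * (c * Q)   ∎)
  cross′ = +-cancelʳ-≡ m _ _ (begin
    numer F c * p F + m′ + m                    ≡⟨ +-assoc (numer F c * p F) m′ m ⟩
    numer F c * p F + (m′ + m)                  ≡⟨ cong (_+_ (numer F c * p F)) m′+m≡cQ ⟩
    numer F c * p F + c * Q                     ≡⟨ expand c (p F) (p⁻ F) Q ⟩
    c * (p F * p F + Q) + p F * p⁻ F            ≡⟨ cong₂ (λ u v → c * u + v) norm cross ⟩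
    c * (k * (q F * q F)) + (k * (q F * q⁻ F) + m) ≡⟨ collect c k (q F) (q⁻ F) m ⟩
    k * (denom F c * q F) + m                   ∎)
    where
    expand : ∀ c p p⁻ Q → (c * p + p⁻) * p + c * Q ≡ c * (p * p + Q) + p * p⁻
    expand = solve-∀
    collect : ∀ c k q q⁻ m → c * (k * (q * q)) + (k * (q * q⁻) + m) ≡ k * ((c * q + q⁻) * q) + m
    collect = solve-∀

-- |X − m| ≤ s, so (X − m)² < k
cross-bound : ∀ {s k X m} → s * s < k → X ≤ s + m → m ≤ s → X * X + m * m < k + 2 * m * X
cross-bound {s} {k} {X} {m} s²<k X≤s+m m≤s with m ≤? X
... | yes m≤X = begin-strict
  X * X + m * m          ≡⟨ cong (λ z → z * z + m * m) y+m≡X ⟨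
  (y + m) * (y + m) + m * m ≡⟨ square-gap y m ⟩
  2 * m * (y + m) + y * y ≡⟨ cong (λ z → 2 * m * z + y * y) y+m≡X ⟩
  2 * m * X + y * y      <⟨ +-monoʳ-< (2 * m * X) (≤-<-trans (*-mono-≤ y≤s y≤s) s²<k) ⟩
  2 * m * X + k          ≡⟨ +-comm (2 * m * X) k ⟩
  k + 2 * m * X          ∎
  where
  open ≤-Reasoning
  y = X ∸ m
  y+m≡X = m∸n+n≡m m≤X
  y≤s : y ≤ s
  y≤s = +-cancelʳ-≤ m y s (subst (_≤ s + m) (sym y+m≡X) X≤s+m)
  square-gap : ∀ y u → (y + u) * (y + u) + u * u ≡ 2 * u * (y + u) + y * y
  square-gap = solve-∀
... | no m≰X = begin-strict
  X * X + m * m          ≡⟨ cong (λ z → X * X + z * z) y+X≡m ⟨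
  X * X + (y + X) * (y + X) ≡⟨ square-gap y X ⟩
  2 * (y + X) * X + y * y ≡⟨ cong (λ z → 2 * z * X + y * y) y+X≡m ⟩
  2 * m * X + y * y      <⟨ +-monoʳ-< (2 * m * X) (≤-<-trans (*-mono-≤ y≤s y≤s) s²<k) ⟩
  2 * m * X + k          ≡⟨ +-comm (2 * m * X) k ⟩
  k + 2 * m * X          ∎
  where
  open ≤-Reasoning
  y = m ∸ X
  y+X≡m = m∸n+n≡m (<⇒≤ (≰⇒> m≰X))
  y≤s : y ≤ s
  y≤s = ≤-trans (m∸n≤m m X) m≤s
  square-gap : ∀ y u → u * u + (y + u) * (y + u) ≡ 2 * (y + u) * u + y * y
  square-gap = solve-∀

-- the semiconvergents j ≤ c of a frame all lie on the same side of √k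
semiconvergent-gap : ∀ {s k Q m Q⁻} → s * s < k → Reduced s k Q m Q⁻ → ∀ j → j * Q ≤ s + m →
  j * (j * Q) < Q⁻ + j * (2 * m)
semiconvergent-gap {s} {k} {Q@(suc _)} {m} {Q⁻} s²<k (reduced _ m≤s _ Q⁻Q+m²≡k) j jQ≤s+m =
  *-cancelˡ-< Q _ _ (+-cancelʳ-< (m * m) _ _ (begin-strict
    Q * (j * (j * Q)) + m * m       ≡⟨ cong (_+ m * m) (square j Q) ⟩
    (j * Q) * (j * Q) + m * m       <⟨ cross-bound s²<k jQ≤s+m m≤s ⟩
    k + 2 * m * (j * Q)             ≡⟨ cong (_+ 2 * m * (j * Q)) Q⁻Q+m²≡k ⟨
    (Q⁻ * Q + m * m) + 2 * m * (j * Q) ≡⟨ expand Q j m Q⁻ ⟩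
    Q * (Q⁻ + j * (2 * m)) + m * m  ∎))
  where
  open ≤-Reasoning
  square : ∀ j Q → Q * (j * (j * Q)) ≡ (j * Q) * (j * Q)
  square = solve-∀
  expand : ∀ Q j m Q⁻ → (Q⁻ * Q + m * m) + 2 * m * (j * Q) ≡ Q * (Q⁻ + j * (2 * m)) + m * m
  expand = solve-∀

-- frames k r = (p_{r−1}, q_{r−1}, p_{r−2}, q_{r−2}), so semi (frames k r) b is [c₀; …, c_{r−1}, b]
frames : ℕ → ℕ → Frame
frames k zero    = frame 1 0 0 1
frames k (suc r) = next (cf k r) (frames k r)

module _ (k : ℕ) where

  private
    prefix : ℕ → List ℕ
    prefix r = map (cf k) (upTo r)

    apply : Frame → ℕ × ℕ → ℕ × ℕ
    apply F (x , y) = x * p F + y * p⁻ F , x * q F + y * q⁻ F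

    prefix-suc : ∀ r t → prefix (suc r) ++ t ≡ prefix r ++ (cf k r ∷ t)
    prefix-suc r t = begin
      map (cf k) (upTo (suc r)) ++ t            ≡⟨ cong (λ z → map (cf k) z ++ t) (upTo-∷ʳ r) ⟨
      map (cf k) (upTo r ++ (r ∷ [])) ++ t      ≡⟨ cong (_++ t) (map-++ (cf k) (upTo r) (r ∷ [])) ⟩
      (prefix r ++ (cf k r ∷ [])) ++ t          ≡⟨ ++-assoc (prefix r) _ t ⟩
      prefix r ++ (cf k r ∷ t)                  ∎
      where open ≡-Reasoning

    cfValue-prefix : ∀ r t → cfValue (prefix r ++ t) ≡ apply (frames k r) (cfValue t)
    cfValue-prefix zero t = cong₂ _,_ (unit₁ x y) (unit₂ x y)
      where
      x = proj₁ (cfValue t)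
      y = proj₂ (cfValue t)
      unit₁ : ∀ x y → x ≡ x * 1 + y * 0
      unit₁ = solve-∀
      unit₂ : ∀ x y → y ≡ x * 0 + y * 1
      unit₂ = solve-∀
    cfValue-prefix (suc r) t = begin
      cfValue (prefix (suc r) ++ t)             ≡⟨ cong cfValue (prefix-suc r t) ⟩
      cfValue (prefix r ++ (cf k r ∷ t))        ≡⟨ cfValue-prefix r (cf k r ∷ t) ⟩
      apply F (cfValue (cf k r ∷ t))
        ≡⟨ cong₂ _,_ (shift x y (cf k r) (p F) (p⁻ F)) (shift x y (cf k r) (q F) (q⁻ F)) ⟩
      apply (next (cf k r) F) (cfValue t)       ∎
      where
      open ≡-Reasoning
      F = frames k r
      x = proj₁ (cfValue t)
      y = proj₂ (cfValue t)
      shift : ∀ x y c a a⁻ → (c * x + y) * a + x * a⁻ ≡ x * (c * a + a⁻) + y * a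
      shift = solve-∀

  cfValue-semiconvList : ∀ r b → cfValue (semiconvList k r b) ≡ semi (frames k r) b
  cfValue-semiconvList r b = trans (cfValue-prefix r (b ∷ [])) (cong₂ _,_ (tidy b _ _) (tidy b _ _))
    where
    tidy : ∀ b a a⁻ → (b * 1 + 0) * a + 1 * a⁻ ≡ b * a + a⁻
    tidy = solve-∀

double : ℕ → ℕ
double zero    = zero
double (suc i) = suc (suc (double i))

module Expansion {k : ℕ} (k≥1 : 1 ≤ k) (non-square : ∀ m → ¬ (m * m ≡ k)) where

  s : ℕ
  s = fsqrt k

  s²<k : s * s < k
  s²<k = ≤∧≢⇒< (fsqrt-sq≤ k) (non-square s)

  m[_] Q[_] : ℕ → ℕ
  m[ r ] = proj₁ (cfState k r)
  Q[ r ] = proj₂ (cfState k r)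

  AboveAt BelowAt : ℕ → Set
  AboveAt r = ∃[ Q⁻ ] (Reduced s k Q[ r ] m[ r ] Q⁻ × LatestAbove k (frames k r) m[ r ] Q[ r ] Q⁻)
  BelowAt r = ∃[ Q⁻ ] (Reduced s k Q[ r ] m[ r ] Q⁻ × LatestBelow k (frames k r) m[ r ] Q[ r ] Q⁻)

  reduced-step-at : ∀ {r Q⁻} → Reduced s k Q[ r ] m[ r ] Q⁻ →
    m[ suc r ] + m[ r ] ≡ cf k r * Q[ r ] × 1 ≤ cf k r × Reduced s k Q[ suc r ] m[ suc r ] Q[ r ] ×
    Q[ suc r ] + cf k r * (cf k r * Q[ r ]) ≡ Q⁻ + cf k r * (2 * m[ r ])
  reduced-step-at {r} {Q⁻} = reduced-step s²<k (<-suc-fsqrt-sq k) {Q[ r ]} {m[ r ]} {Q⁻}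

  above⇒below-at : ∀ {r} → AboveAt r → BelowAt (suc r)
  above⇒below-at {r} (_ , R , A) =
    let (m′+m≡cQ , _ , R′ , Q′-rec) = reduced-step-at {r} R
    in Q[ r ] , R′ , above⇒below {c = cf k r} A m′+m≡cQ Q′-rec

  below⇒above-at : ∀ {r} → BelowAt r → AboveAt (suc r)
  below⇒above-at {r} (_ , R , B) =
    let (m′+m≡cQ , _ , R′ , Q′-rec) = reduced-step-at {r} R
    in Q[ r ] , R′ , below⇒above {c = cf k r} B m′+m≡cQ Q′-rec

  above-at : ∀ i → AboveAt (double i)
  below-at : ∀ i → BelowAt (suc (double i))

  above-at zero    = k , reduced ≤-refl z≤n 1≤s+0 (trans (+-identityʳ (k * 1)) (*-identityʳ k)) ,
                     latestAbove refl (sym (cong (_+ 1) (*-zeroʳ k))) (sym (*-zeroʳ k)) (sym (*-identityʳ k))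
    where
    1≤s+0 : 1 ≤ s + 0
    1≤s+0 = subst (1 ≤_) (sym (+-identityʳ s)) (fsqrt-greatest k≥1)
  above-at (suc i) = below⇒above-at {suc (double i)} (below-at i)

  below-at i = above⇒below-at {double i} (above-at i)

  cf≥1 : ∀ {r Q⁻} → Reduced s k Q[ r ] m[ r ] Q⁻ → 1 ≤ cf k r
  cf≥1 {r} R = proj₁ (proj₂ (reduced-step-at {r} R))

  private
    semiconvergent-gap-at : ∀ {r Q⁻} → Reduced s k Q[ r ] m[ r ] Q⁻ → ∀ j → j ≤ cf k r →
      j * (j * Q[ r ]) < Q⁻ + j * (2 * m[ r ])
    semiconvergent-gap-at {r} R j j≤c = semiconvergent-gap s²<k R j
      (≤-trans (*-monoˡ-≤ Q[ r ] j≤c) (div'-*-≤ (s + m[ r ]) Q[ r ] (Reduced.Q≥1 R)))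

  above-semiconvergent-below : ∀ {r} → AboveAt r → ∀ j → j ≤ cf k r →
    numer (frames k r) j * numer (frames k r) j < k * (denom (frames k r) j * denom (frames k r) j)
  above-semiconvergent-below {r} (_ , R , A) j j≤c =
    +-cancelʳ-< _ _ _
      (<-≤-trans (+-monoʳ-< _ (semiconvergent-gap-at {r} R j j≤c)) (≤-reflexive (above-numer-norm A j)))

  below-semiconvergent-above : ∀ {r} → BelowAt r → ∀ j → j ≤ cf k r →
    k * (denom (frames k r) j * denom (frames k r) j) < numer (frames k r) j * numer (frames k r) j
  below-semiconvergent-above {r} (_ , R , B) j j≤c =
    +-cancelʳ-< _ _ _
      (<-≤-trans (+-monoʳ-< _ (semiconvergent-gap-at {r} R j j≤c)) (≤-reflexive (sym (below-numer-norm B j))))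

-- Legendre's criterion and the Stern–Brocot descent

_≺_ : ℕ × ℕ → ℕ × ℕ → Set
(a , b) ≺ (c , e) = a * e < c * b

-- a/b < p/q < c/e with c b − a e = 1 forces p/q = Y (a/b) ⊕ X (c/e) for positive integers X, Y
farey-interior : ∀ {a b c e p q} → c * b ≡ a * e + 1 → (a , b) ≺ (p , q) → (p , q) ≺ (c , e) →
  b + e ≤ q × a + c ≤ p
farey-interior {a} {b} {c} {e} {p} {q} det aq<pb pe<cq = bound b e q≡bY+eX , bound a c p≡aY+cX
  where
  open ≡-Reasoning
  X = p * b ∸ a * q
  Y = c * q ∸ p * e
  X+aq≡pb : X + a * q ≡ p * b
  X+aq≡pb = m∸n+n≡m (<⇒≤ aq<pb)
  Y+pe≡cq : Y + p * e ≡ c * q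
  Y+pe≡cq = m∸n+n≡m (<⇒≤ pe<cq)
  X≥1 : 1 ≤ X
  X≥1 = +-cancelʳ-≤ (a * q) 1 X (subst (suc (a * q) ≤_) (sym X+aq≡pb) aq<pb)
  Y≥1 : 1 ≤ Y
  Y≥1 = +-cancelʳ-≤ (p * e) 1 Y (subst (suc (p * e) ≤_) (sym Y+pe≡cq) pe<cq)
  q≡bY+eX : b * Y + e * X ≡ q
  q≡bY+eX = +-cancelʳ-≡ (b * (p * e) + e * (a * q)) _ _ (begin
    b * Y + e * X + (b * (p * e) + e * (a * q)) ≡⟨ expand b e p a q X Y ⟩
    b * (Y + p * e) + e * (X + a * q)          ≡⟨ cong₂ (λ u v → b * u + e * v) Y+pe≡cq X+aq≡pb ⟩
    b * (c * q) + e * (p * b)                  ≡⟨ regroup a b c e p q ⟩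
    q * (c * b) + b * (p * e)                  ≡⟨ cong (λ z → q * z + b * (p * e)) det ⟩
    q * (a * e + 1) + b * (p * e)              ≡⟨ collect a b e p q ⟩
    q + (b * (p * e) + e * (a * q))            ∎)
    where
    expand : ∀ b e p a q X Y → b * Y + e * X + (b * (p * e) + e * (a * q)) ≡ b * (Y + p * e) + e * (X + a * q)
    expand = solve-∀
    regroup : ∀ a b c e p q → b * (c * q) + e * (p * b) ≡ q * (c * b) + b * (p * e)
    regroup = solve-∀
    collect : ∀ a b e p q → q * (a * e + 1) + b * (p * e) ≡ q + (b * (p * e) + e * (a * q))
    collect = solve-∀
  p≡aY+cX : a * Y + c * X ≡ p
  p≡aY+cX = +-cancelʳ-≡ (a * (p * e) + c * (a * q)) _ _ (begin
    a * Y + c * X + (a * (p * e) + c * (a * q)) ≡⟨ expand a c p e q X Y ⟩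
    a * (Y + p * e) + c * (X + a * q)          ≡⟨ cong₂ (λ u v → a * u + c * v) Y+pe≡cq X+aq≡pb ⟩
    a * (c * q) + c * (p * b)                  ≡⟨ regroup a b c e p q ⟩
    p * (c * b) + c * (a * q)                  ≡⟨ cong (λ z → p * z + c * (a * q)) det ⟩
    p * (a * e + 1) + c * (a * q)              ≡⟨ collect a c e p q ⟩
    p + (a * (p * e) + c * (a * q))            ∎)
    where
    expand : ∀ a c p e q X Y → a * Y + c * X + (a * (p * e) + c * (a * q)) ≡ a * (Y + p * e) + c * (X + a * q)
    expand = solve-∀
    regroup : ∀ a b c e p q → a * (c * q) + c * (p * b) ≡ p * (c * b) + c * (a * q)
    regroup = solve-∀
    collect : ∀ a c e p q → p * (a * e + 1) + c * (a * q) ≡ p + (a * (p * e) + c * (a * q))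
    collect = solve-∀
  bound : ∀ u v {w} → u * Y + v * X ≡ w → u + v ≤ w
  bound u v eq = subst (u + v ≤_) eq (+-mono-≤ (m≤m*n u Y) (m≤m*n v X))
    where
    instance
      _ = >-nonZero X≥1
      _ = >-nonZero Y≥1

-- p/q approximates √k so closely that no fraction of denominator at most q lies strictly
-- between p/q and √k
CloseBelow : ℕ → ℕ → ℕ → Set
CloseBelow k p q = ∃[ N ] (k * (q * q) ≡ p * p + N × N * q ≤ 2 * p)

CloseAbove : ℕ → ℕ → ℕ → ℕ → Set
CloseAbove k s p q = ∃[ M ] (p * p ≡ k * (q * q) + M × M ≤ 2 * s)

Close : ℕ → ℕ → ℕ → ℕ → Set
Close k s p q = CloseBelow k p q ⊎ CloseAbove k s p q

square-* : ∀ a b → (a * b) * (a * b) ≡ (a * a) * (b * b)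
square-* = solve-∀

-- (p n + 1)² ≤ (a q)² < k n² q² = n² (p² + N) gives 2 p n + 1 < n² N ≤ n q N ≤ 2 p n
between-below⇒¬close : ∀ {k s a n p q} → a * a < k * (n * n) → (p , q) ≺ (a , n) → n ≤ q → 1 ≤ q →
  ¬ Close k s p q
between-below⇒¬close {k} {s} {a} {n} {p} {q} a²<kn² pn<aq n≤q q≥1 (inj₁ (N , kq²≡p²+N , Nq≤2p)) =
  <-irrefl refl (<-≤-trans 2pn+1<n²N n²N≤2pn+1)
  where
  instance _ = >-nonZero (*-mono-≤ q≥1 q≥1)
  [pn+1]²<n²[p²+N] : (p * n + 1) * (p * n + 1) < n * n * (p * p + N)
  [pn+1]²<n²[p²+N] = begin-strict
    (p * n + 1) * (p * n + 1) ≤⟨ *-mono-≤ pn+1≤aq pn+1≤aq ⟩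
    (a * q) * (a * q)         ≡⟨ square-* a q ⟩
    (a * a) * (q * q)         <⟨ *-monoˡ-< (q * q) a²<kn² ⟩
    k * (n * n) * (q * q)     ≡⟨ swap k n q ⟩
    n * n * (k * (q * q))     ≡⟨ cong (n * n *_) kq²≡p²+N ⟩
    n * n * (p * p + N)       ∎
    where
    open ≤-Reasoning
    pn+1≤aq = subst (_≤ a * q) (+-comm 1 (p * n)) pn<aq
    swap : ∀ k n q → k * (n * n) * (q * q) ≡ n * n * (k * (q * q))
    swap = solve-∀
  2pn+1<n²N : 2 * p * n + 1 < n * n * N
  2pn+1<n²N = +-cancelˡ-< (n * n * (p * p)) _ _
    (subst₂ _<_ (expand p n) (*-distribˡ-+ (n * n) (p * p) N) [pn+1]²<n²[p²+N])
    where
    expand : ∀ p n → (p * n + 1) * (p * n + 1) ≡ n * n * (p * p) + (2 * p * n + 1)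
    expand = solve-∀
  n²N≤2pn+1 : n * n * N ≤ 2 * p * n + 1
  n²N≤2pn+1 = begin
    n * n * N    ≡⟨ *-assoc n n N ⟩
    n * (n * N)  ≤⟨ *-monoʳ-≤ n (*-monoˡ-≤ N n≤q) ⟩
    n * (q * N)  ≡⟨ cong (n *_) (*-comm q N) ⟩
    n * (N * q)  ≤⟨ *-monoʳ-≤ n Nq≤2p ⟩
    n * (2 * p)  ≡⟨ *-comm n (2 * p) ⟩
    2 * p * n    ≤⟨ m≤m+n (2 * p * n) 1 ⟩
    2 * p * n + 1 ∎
    where open ≤-Reasoning
between-below⇒¬close {k} {s} {a} {n} {p} {q} a²<kn² pn<aq n≤q q≥1 (inj₂ (M , p²≡kq²+M , _)) =
  <⇒≱ p²<kq² (subst (k * (q * q) ≤_) (sym p²≡kq²+M) (m≤m+n _ M))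
  where
  instance _ = >-nonZero (*-mono-≤ q≥1 q≥1)
  p²<kq² : p * p < k * (q * q)
  p²<kq² = *-cancelʳ-< (n * n) _ _ (begin-strict
    (p * p) * (n * n)      ≡⟨ square-* p n ⟨
    (p * n) * (p * n)      <⟨ *-mono-< pn<aq pn<aq ⟩
    (a * q) * (a * q)      ≡⟨ square-* a q ⟩
    (a * a) * (q * q)      <⟨ *-monoˡ-< (q * q) a²<kn² ⟩
    k * (n * n) * (q * q)  ≡⟨ swap k n q ⟩
    (k * (q * q)) * (n * n) ∎)
    where
    open ≤-Reasoning
    swap : ∀ k n q → k * (n * n) * (q * q) ≡ (k * (q * q)) * (n * n)
    swap = solve-∀

-- k n² q² + 2 a q + 1 < (a q + 1)² ≤ (p n)² = k n² q² + n² M gives 2 a q < n² M ≤ 2 s n q < 2 a q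
between-above⇒¬close : ∀ {k s a n p q} → s * s ≤ k → k * (n * n) < a * a → (a , n) ≺ (p , q) → n ≤ q → 1 ≤ q →
  ¬ Close k s p q
between-above⇒¬close {k} {s} {a} {n} {p} {q} s²≤k kn²<a² aq<pn n≤q q≥1 (inj₂ (M , p²≡kq²+M , M≤2s)) =
  <-irrefl refl (<-≤-trans 2aq<n²M n²M≤2aq)
  where
  instance _ = >-nonZero (*-mono-≤ q≥1 q≥1)
  2aq<n²M : 2 * a * q < n * n * M
  2aq<n²M = ≤-trans (s≤s (m≤m+n (2 * a * q) 1)) (+-cancelˡ-< (k * (n * n) * (q * q)) _ _ (begin-strict
    k * (n * n) * (q * q) + (2 * a * q + 1) <⟨ +-monoˡ-< _ (*-monoˡ-< (q * q) kn²<a²) ⟩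
    (a * a) * (q * q) + (2 * a * q + 1)     ≡⟨ expand a q ⟨
    (a * q + 1) * (a * q + 1)               ≤⟨ *-mono-≤ aq+1≤pn aq+1≤pn ⟩
    (p * n) * (p * n)                       ≡⟨ square-* p n ⟩
    (p * p) * (n * n)                       ≡⟨ cong (_* (n * n)) p²≡kq²+M ⟩
    (k * (q * q) + M) * (n * n)             ≡⟨ regroup k n q M ⟩
    k * (n * n) * (q * q) + n * n * M       ∎))
    where
    open ≤-Reasoning
    aq+1≤pn = subst (_≤ p * n) (+-comm 1 (a * q)) aq<pn
    expand : ∀ a q → (a * q + 1) * (a * q + 1) ≡ (a * a) * (q * q) + (2 * a * q + 1)
    expand = solve-∀
    regroup : ∀ k n q M → (k * (q * q) + M) * (n * n) ≡ k * (n * n) * (q * q) + n * n * M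
    regroup = solve-∀
  sn<a : s * n < a
  sn<a = m*m<n*n⇒m<n (begin-strict
    (s * n) * (s * n)  ≡⟨ square-* s n ⟩
    (s * s) * (n * n)  ≤⟨ *-monoˡ-≤ (n * n) s²≤k ⟩
    k * (n * n)        <⟨ kn²<a² ⟩
    a * a              ∎)
    where open ≤-Reasoning
  n²M≤2aq : n * n * M ≤ 2 * a * q
  n²M≤2aq = begin
    n * n * M        ≤⟨ *-monoʳ-≤ (n * n) M≤2s ⟩
    n * n * (2 * s)  ≤⟨ *-monoˡ-≤ (2 * s) (*-monoˡ-≤ n n≤q) ⟩
    q * n * (2 * s)  ≡⟨ regroup q n s ⟩
    2 * q * (s * n)  ≤⟨ *-monoʳ-≤ (2 * q) (<⇒≤ sn<a) ⟩
    2 * q * a        ≡⟨ regroup′ q a ⟩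
    2 * a * q        ∎
    where
    open ≤-Reasoning
    regroup : ∀ q n s → q * n * (2 * s) ≡ 2 * q * (s * n)
    regroup = solve-∀
    regroup′ : ∀ q a → 2 * q * a ≡ 2 * a * q
    regroup′ = solve-∀
between-above⇒¬close {k} {s} {a} {n} {p} {q} s²≤k kn²<a² aq<pn n≤q q≥1 (inj₁ (N , kq²≡p²+N , _)) =
  <⇒≱ kq²<p² (subst (p * p ≤_) (sym kq²≡p²+N) (m≤m+n _ N))
  where
  instance _ = >-nonZero (*-mono-≤ q≥1 q≥1)
  kq²<p² : k * (q * q) < p * p
  kq²<p² = *-cancelʳ-< (n * n) _ _ (begin-strict
    (k * (q * q)) * (n * n) ≡⟨ swap k n q ⟩
    k * (n * n) * (q * q)   <⟨ *-monoˡ-< (q * q) kn²<a² ⟩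
    (a * a) * (q * q)       ≡⟨ square-* a q ⟨
    (a * q) * (a * q)       <⟨ *-mono-< aq<pn aq<pn ⟩
    (p * n) * (p * n)       ≡⟨ square-* p n ⟩
    (p * p) * (n * n)       ∎)
    where
    open ≤-Reasoning
    swap : ∀ k n q → (k * (q * q)) * (n * n) ≡ k * (n * n) * (q * q)
    swap = solve-∀

numer-suc : ∀ F j → numer F (suc j) ≡ p F + numer F j
numer-suc F j = +-assoc (p F) (j * p F) (p⁻ F)

denom-suc : ∀ F j → denom F (suc j) ≡ q F + denom F j
denom-suc F j = +-assoc (q F) (j * q F) (q⁻ F)

mediant-size : Frame → ℕ → ℕ
mediant-size F j = numer F j + denom F j

mediant-size-suc : ∀ F j → mediant-size F (suc j) ≡ (p F + q F) + mediant-size F j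
mediant-size-suc F j =
  trans (cong₂ _+_ (numer-suc F j) (denom-suc F j)) (shuffle (p F) (numer F j) (q F) (denom F j))
  where
  shuffle : ∀ a b c d → (a + b) + (c + d) ≡ (a + c) + (b + d)
  shuffle = solve-∀

mediant-size-next : ∀ F {j c} → suc j ≡ c → mediant-size (next c F) 1 ≡ (p F + q F) + mediant-size F (suc j)
mediant-size-next F {j} refl = shuffle (numer F (suc j)) (p F) (denom F (suc j)) (q F)
  where
  shuffle : ∀ a b c d → (1 * a + b) + (1 * c + d) ≡ (b + d) + (a + c)
  shuffle = solve-∀

-- Walking down the Stern–Brocot tree along the semiconvergents of √k: at every step x/y lies strictly
-- between the latest convergent and the current semiconvergent, and closeness rules out that it passes
-- the next one on the side of √k.  Fuel bounds the walk, since mediant sizes grow and stay ≤ x + y.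
module Descent {k : ℕ} (k≥1 : 1 ≤ k) (non-square : ∀ m → ¬ (m * m ≡ k))
               {x y : ℕ} (y≥1 : 1 ≤ y) (close : Close k (fsqrt k) x y) where

  open Expansion k≥1 non-square

  Semiconvergent : Set
  Semiconvergent = ∃[ r ] ∃[ b ] (b ≤ cf k r × (x , y) ≈P semi (frames k r) b)

  private
    Fᵉ Fᵒ : ℕ → Frame
    Fᵉ i = frames k (double i)
    Fᵒ i = frames k (suc (double i))

    advance : ∀ f F {μ μ′} → 1 ≤ p F + q F → μ′ ≡ (p F + q F) + μ → x + y < suc f + μ → x + y < f + μ′
    advance f F {μ} {μ′} pos μ′≡ fuel = <-≤-trans (subst (x + y <_) (sym (+-suc f μ)) fuel)
      (+-monoʳ-≤ f (subst (suc μ ≤_) (sym μ′≡) (+-monoˡ-≤ μ pos)))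

    1≤p+q-above : ∀ i → 1 ≤ p (Fᵉ i) + q (Fᵉ i)
    1≤p+q-above i = ≤-trans (*-pos⇒posˡ {p F} {q⁻ F} (subst (1 ≤_) (sym det) (m≤n+m 1 _))) (m≤m+n (p F) (q F))
      where
      F = Fᵉ i
      det = LatestAbove.det (proj₂ (proj₂ (above-at i)))

    1≤p+q-below : ∀ i → 1 ≤ p (Fᵒ i) + q (Fᵒ i)
    1≤p+q-below i = ≤-trans (*-pos⇒posˡ {q F} {p⁻ F} (subst (1 ≤_) det′ (m≤n+m 1 _))) (m≤n+m (q F) (p F))
      where
      F = Fᵒ i
      det′ = trans (sym (LatestBelow.det (proj₂ (proj₂ (below-at i))))) (*-comm (p⁻ F) (q F))

    ¬below : ∀ a n → a * a < k * (n * n) → (x , y) ≺ (a , n) → n ≤ y → ⊥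
    ¬below a n a²<kn² x/y<a/n n≤y =
      between-below⇒¬close {k} {fsqrt k} {a} {n} {x} {y} a²<kn² x/y<a/n n≤y y≥1 close

    ¬above : ∀ a n → k * (n * n) < a * a → (a , n) ≺ (x , y) → n ≤ y → ⊥
    ¬above a n kn²<a² a/n<x/y n≤y =
      between-above⇒¬close {k} {fsqrt k} {a} {n} {x} {y} (<⇒≤ s²<k) kn²<a² a/n<x/y n≤y y≥1 close

  -- in an even frame the convergent lies above √k and its semiconvergents below
  above-dichotomy : ∀ i j → j < cf k (double i) →
    semi (Fᵉ i) j ≺ (x , y) → (x , y) ≺ (p (Fᵉ i) , q (Fᵉ i)) →
    mediant-size (Fᵉ i) (suc j) ≤ x + y ×
    ((x , y) ≈P semi (Fᵉ i) (suc j) ⊎ semi (Fᵉ i) (suc j) ≺ (x , y))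
  above-dichotomy i j j<c lower upper = +-mono-≤ Mp≤x Mq≤y , trichotomy
    where
    F = Fᵉ i
    Mp = numer F (suc j)
    Mq = denom F (suc j)
    between = farey-interior {numer F j} {denom F j} {p F} {q F} {x} {y}
                (above-det-step j (p F) (p⁻ F) (q F) (q⁻ F) (LatestAbove.det (proj₂ (proj₂ (above-at i)))))
                lower upper
    Mq≤y = subst (_≤ y) (trans (+-comm (denom F j) (q F)) (sym (denom-suc F j))) (proj₁ between)
    Mp≤x = subst (_≤ x) (trans (+-comm (numer F j) (p F)) (sym (numer-suc F j))) (proj₂ between)
    trichotomy : (x , y) ≈P (Mp , Mq) ⊎ (Mp , Mq) ≺ (x , y)
    trichotomy with <-cmp (x * Mq) (Mp * y)
    ... | tri≈ _ hit _ = inj₁ hit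
    ... | tri> _ _ gt  = inj₂ gt
    ... | tri< lt _ _  =
      ⊥-elim (¬below Mp Mq (above-semiconvergent-below {double i} (above-at i) (suc j) j<c) lt Mq≤y)

  below-dichotomy : ∀ i j → j < cf k (suc (double i)) →
    (p (Fᵒ i) , q (Fᵒ i)) ≺ (x , y) → (x , y) ≺ semi (Fᵒ i) j →
    mediant-size (Fᵒ i) (suc j) ≤ x + y ×
    ((x , y) ≈P semi (Fᵒ i) (suc j) ⊎ (x , y) ≺ semi (Fᵒ i) (suc j))
  below-dichotomy i j j<c lower upper = +-mono-≤ Mp≤x Mq≤y , trichotomy
    where
    F = Fᵒ i
    Mp = numer F (suc j)
    Mq = denom F (suc j)
    between = farey-interior {p F} {q F} {numer F j} {denom F j} {x} {y}
                (below-det-step j (p F) (p⁻ F) (q F) (q⁻ F) (LatestBelow.det (proj₂ (proj₂ (below-at i)))))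
                lower upper
    Mq≤y = subst (_≤ y) (sym (denom-suc F j)) (proj₁ between)
    Mp≤x = subst (_≤ x) (sym (numer-suc F j)) (proj₂ between)
    trichotomy : (x , y) ≈P (Mp , Mq) ⊎ (x , y) ≺ (Mp , Mq)
    trichotomy with <-cmp (x * Mq) (Mp * y)
    ... | tri≈ _ hit _ = inj₁ hit
    ... | tri< lt _ _  = inj₂ lt
    ... | tri> _ _ gt  =
      ⊥-elim (¬above Mp Mq (below-semiconvergent-above {suc (double i)} (below-at i) (suc j) j<c) gt Mq≤y)

  descend-above : ∀ f i j → j < cf k (double i) →
    semi (Fᵉ i) j ≺ (x , y) → (x , y) ≺ (p (Fᵉ i) , q (Fᵉ i)) →
    x + y < f + mediant-size (Fᵉ i) (suc j) → Semiconvergent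
  descend-below : ∀ f i j → j < cf k (suc (double i)) →
    (p (Fᵒ i) , q (Fᵒ i)) ≺ (x , y) → (x , y) ≺ semi (Fᵒ i) j →
    x + y < f + mediant-size (Fᵒ i) (suc j) → Semiconvergent

  descend-above zero i j j<c lower upper fuel = ⊥-elim (<⇒≱ fuel (proj₁ (above-dichotomy i j j<c lower upper)))
  descend-above (suc f) i j j<c lower upper fuel with proj₂ (above-dichotomy i j j<c lower upper)
  ... | inj₁ hit = double i , suc j , j<c , hit
  ... | inj₂ M<x/y with m≤n⇒m<n∨m≡n j<c
  ...   | inj₁ 1+j<c =
    descend-above f i (suc j) 1+j<c M<x/y upper
      (advance f (Fᵉ i) (1≤p+q-above i) (mediant-size-suc (Fᵉ i) (suc j)) fuel)
  ...   | inj₂ 1+j≡c =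
    descend-below f i 0 (cf≥1 {suc (double i)} (proj₁ (proj₂ (below-at i))))
      (subst (λ z → semi (Fᵉ i) z ≺ (x , y)) 1+j≡c M<x/y) upper
      (advance f (Fᵉ i) (1≤p+q-above i) (mediant-size-next (Fᵉ i) 1+j≡c) fuel)

  descend-below zero i j j<c lower upper fuel = ⊥-elim (<⇒≱ fuel (proj₁ (below-dichotomy i j j<c lower upper)))
  descend-below (suc f) i j j<c lower upper fuel with proj₂ (below-dichotomy i j j<c lower upper)
  ... | inj₁ hit = suc (double i) , suc j , j<c , hit
  ... | inj₂ x/y<M with m≤n⇒m<n∨m≡n j<c
  ...   | inj₁ 1+j<c =
    descend-below f i (suc j) 1+j<c lower x/y<M
      (advance f (Fᵒ i) (1≤p+q-below i) (mediant-size-suc (Fᵒ i) (suc j)) fuel)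
  ...   | inj₂ 1+j≡c =
    descend-above f (suc i) 0 (cf≥1 {double (suc i)} (proj₁ (proj₂ (above-at (suc i))))) lower
      (subst (λ z → (x , y) ≺ semi (Fᵒ i) z) 1+j≡c x/y<M)
      (advance f (Fᵒ i) (1≤p+q-below i) (mediant-size-next (Fᵒ i) 1+j≡c) fuel)

  close⇒semiconvergent : 1 ≤ x → ∃[ r ] ∃[ b ] (b ≤ cf k r × (x , y) ≈P cfValue (semiconvList k r b))
  close⇒semiconvergent x≥1 =
    let (r , b , b≤c , x/y≈b) = descend-above (x + y) 0 0 (cf≥1 {0} (proj₁ (proj₂ (above-at 0))))
                                  (subst (0 <_) (sym (*-identityʳ x)) x≥1)
                                  (subst (_< 1 * y) (sym (*-zeroʳ x)) (subst (0 <_) (sym (*-identityˡ y)) y≥1))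
                                  (m<m+n (x + y) (s≤s z≤n))
    in r , b , b≤c , subst ((x , y) ≈P_) (sym (cfValue-semiconvList k r b)) x/y≈b

-- with g = gcd e D: e / g is coprime to D / g and divides (D / g) D, hence divides D
square-divisor-split : ∀ {e D} → 1 ≤ e → e ∣ D * D →
  ∃[ α ] ∃[ β ] (α * β ≡ e × α ∣ D × β ∣ D × β ≤ α × 1 ≤ α × 1 ≤ β)
square-divisor-split {e} {D} e≥1 (divides w D²≡we) =
  g , β , gβ≡e , gcd[m,n]∣n e D , β∣D , ∣⇒≤ β∣g , *-pos⇒posˡ (subst (1 ≤_) (sym gβ≡e) e≥1) , β≥1
  where
  g = gcd e D
  instance
    g≢0 : NonZero g
    g≢0 = ≢-nonZero (gcd[m,n]≢0 e D (inj₁ λ e≡0 → <⇒≱ e≥1 (≤-reflexive e≡0)))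
  β = e / g
  v = D / g
  βg≡e : β * g ≡ e
  βg≡e = m/n*n≡m (gcd[m,n]∣m e D)
  gβ≡e : g * β ≡ e
  gβ≡e = m*[n/m]≡n (gcd[m,n]∣m e D)
  vD≡wβ : v * D ≡ w * β
  vD≡wβ = *-cancelʳ-≡ (v * D) (w * β) g (begin
    v * D * g    ≡⟨ swap v D g ⟩
    (v * g) * D  ≡⟨ cong (_* D) (m/n*n≡m (gcd[m,n]∣n e D)) ⟩
    D * D        ≡⟨ D²≡we ⟩
    w * e        ≡⟨ cong (w *_) βg≡e ⟨
    w * (β * g)  ≡⟨ *-assoc w β g ⟨
    w * β * g    ∎)
    where
    open ≡-Reasoning
    swap : ∀ a b c → a * b * c ≡ (a * c) * b
    swap = solve-∀
  β∣D : β ∣ D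
  β∣D = coprime-divisor (coprime-/gcd e D) (divides w vD≡wβ)
  β∣g : β ∣ g
  β∣g = gcd-greatest (m/n∣m (gcd[m,n]∣m e D)) β∣D
  β≥1 : 1 ≤ β
  β≥1 = *-pos⇒posˡ (subst (1 ≤_) (sym (trans (*-comm β g) gβ≡e)) e≥1)

-- The orbit of f

norm : ℕ → ℕ × ℕ → ℤ
norm k (x , y) = + x *ℤ + x - + k *ℤ (+ y *ℤ + y)

δ : ℕ → ℕ → ℤ
δ k d = + d *ℤ + d - + k

pos-affine : ∀ x d y → + (x + d * y) ≡ + x +ℤ + d *ℤ + y
pos-affine x d y = trans (ℤₚ.pos-+ x (d * y)) (cong (+ x +ℤ_) (ℤₚ.pos-* d y))

pos-linear : ∀ a x b y → + (a * x + b * y) ≡ + a *ℤ + x +ℤ + b *ℤ + y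
pos-linear a x b y = trans (ℤₚ.pos-+ (a * x) (b * y)) (cong₂ _+ℤ_ (ℤₚ.pos-* a x) (ℤₚ.pos-* b y))

norm-scale : ∀ k a x y → norm k (a * x , a * y) ≡ + (a * a) *ℤ norm k (x , y)
norm-scale k a x y = begin
  norm k (a * x , a * y)
    ≡⟨ cong₂ (λ u w → u *ℤ u - + k *ℤ (w *ℤ w)) (ℤₚ.pos-* a x) (ℤₚ.pos-* a y) ⟩
  (+ a *ℤ + x) *ℤ (+ a *ℤ + x) - + k *ℤ ((+ a *ℤ + y) *ℤ (+ a *ℤ + y))
    ≡⟨ factor (+ k) (+ a) (+ x) (+ y) ⟩
  + a *ℤ + a *ℤ norm k (x , y)
    ≡⟨ cong (_*ℤ norm k (x , y)) (ℤₚ.pos-* a a) ⟨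
  + (a * a) *ℤ norm k (x , y) ∎
  where
  open ≡-Reasoning
  factor : ∀ K a u w →
    (a *ℤ u) *ℤ (a *ℤ u) - K *ℤ ((a *ℤ w) *ℤ (a *ℤ w)) ≡ a *ℤ a *ℤ (u *ℤ u - K *ℤ (w *ℤ w))
  factor = ℤ-Ring.solve-∀

norm-fPair : ∀ k d v → norm k (fPair k d v) ≡ δ k d *ℤ norm k v
norm-fPair k d (x , y) =
  trans (cong₂ (λ u w → u *ℤ u - + k *ℤ (w *ℤ w)) (pos-linear d x k y) (pos-affine x d y))
        (multiplicative (+ k) (+ d) (+ x) (+ y))
  where
  multiplicative : ∀ K D u w → let u′ = D *ℤ u +ℤ K *ℤ w ; w′ = u +ℤ D *ℤ w in
    u′ *ℤ u′ - K *ℤ (w′ *ℤ w′) ≡ (D *ℤ D - K) *ℤ (u *ℤ u - K *ℤ (w *ℤ w))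
  multiplicative = ℤ-Ring.solve-∀

norm≡pos-diff : ∀ k x y → norm k (x , y) ≡ + (x * x) - + (k * (y * y))
norm≡pos-diff k x y =
  sym (cong₂ _-_ (ℤₚ.pos-* x x) (trans (ℤₚ.pos-* k (y * y)) (cong (+ k *ℤ_) (ℤₚ.pos-* y y))))

pos-diff≡pos : ∀ {a b c} → + a - + b ≡ + c → a ≡ b + c
pos-diff≡pos {a} {b} {c} h = ℤₚ.+-injective (begin
  + a               ≡⟨ cancel (+ a) (+ b) ⟩
  (+ a - + b) +ℤ + b ≡⟨ cong (_+ℤ + b) h ⟩
  + c +ℤ + b         ≡⟨ ℤₚ.+-comm (+ c) (+ b) ⟩
  + b +ℤ + c         ≡⟨ ℤₚ.pos-+ b c ⟨
  + (b + c)          ∎)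
  where
  open ≡-Reasoning
  cancel : ∀ i j → i ≡ (i - j) +ℤ j
  cancel = ℤ-Ring.solve-∀

pos-diff≡neg : ∀ {a b c} → + a - + b ≡ -ℤ + c → b ≡ a + c
pos-diff≡neg {a} {b} {c} h = ℤₚ.+-injective (begin
  + b                  ≡⟨ cancel (+ a) (+ b) ⟩
  + a - (+ a - + b)    ≡⟨ cong (+ a -_) h ⟩
  + a - -ℤ + c         ≡⟨ negate (+ a) (+ c) ⟩
  + a +ℤ + c           ≡⟨ ℤₚ.pos-+ a c ⟨
  + (a + c)            ∎)
  where
  open ≡-Reasoning
  cancel : ∀ i j → j ≡ i - (i - j)
  cancel = ℤ-Ring.solve-∀
  negate : ∀ i c → i - -ℤ c ≡ i +ℤ c
  negate = ℤ-Ring.solve-∀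

norm≡pos⇒ : ∀ k x y {M} → norm k (x , y) ≡ + M → x * x ≡ k * (y * y) + M
norm≡pos⇒ k x y h = pos-diff≡pos (trans (sym (norm≡pos-diff k x y)) h)

norm≡neg⇒ : ∀ k x y {N} → norm k (x , y) ≡ -ℤ + N → k * (y * y) ≡ x * x + N
norm≡neg⇒ k x y h = pos-diff≡neg (trans (sym (norm≡pos-diff k x y)) h)

square-abs : ∀ i → i *ℤ i ≡ + (abs i * abs i)
square-abs (+ n)    = ℤₚ.+◃n≡+n (n * n)
square-abs -[1+ n ] = refl

record OrbitPoint (k d g : ℕ) (n : ℤ) (v : ℕ × ℕ) : Set where
  constructor orbitPoint
  field
    num≥1  : 1 ≤ proj₁ v
    den≥1  : 1 ≤ proj₂ v
    norm≡  : norm k v ≡ n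
    g∣x+dy : g ∣ proj₁ v + d * proj₂ v

-- a x′ = d (x + d y) − δ y, so a ∣ x + d y makes f(x/y) divisible by a, and then
-- a (x′ + d t) = 2 d (a t) − δ y is divisible by a b
module _ {k d a b : ℕ} (k≥1 : 1 ≤ k) (a≥1 : 1 ≤ a) (∣δ∣≡ab : abs (δ k d) ≡ a * b) (b∣2d : b ∣ 2 * d)
  where

  private
    instance
      a≢0 : NonZero a
      a≢0 = >-nonZero a≥1
      a²≢0 : ℤ.NonZero (+ (a * a))
      a²≢0 = ℤ.>-nonZero (ℤ.+<+ (*-mono-≤ a≥1 a≥1))

  orbit-step : ∀ {n n′ v} → + (a * a) *ℤ n′ ≡ δ k d *ℤ n → OrbitPoint k d a n v →
               ∃[ w ] (fPair k d v ≡ (a * proj₁ w , a * proj₂ w) × OrbitPoint k d b n′ w)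
  orbit-step {n} {n′} {x , y} a²n′≡δn (orbitPoint x≥1 y≥1 norm≡n (divides t x+dy≡ta)) =
    (x′ , t) , fPair≡ , orbitPoint x′≥1 t≥1 norm≡n′ b∣x′+dt
    where
    open ≡-Reasoning
    ab∣δ : + (a * b) ℤ∣.∣ δ k d
    ab∣δ = ℤ∣.∣ᵤ⇒∣ {+ (a * b)} {δ k d} (subst (a * b ∣_) (sym ∣δ∣≡ab) ∣-refl)

    dx+ky≡ : + (d * x + k * y) ≡ + d *ℤ + (t * a) - δ k d *ℤ + y
    dx+ky≡ = begin
      + (d * x + k * y)                          ≡⟨ pos-linear d x k y ⟩
      + d *ℤ + x +ℤ + k *ℤ + y                   ≡⟨ expand (+ d) (+ x) (+ k) (+ y) ⟩
      + d *ℤ (+ x +ℤ + d *ℤ + y) - δ k d *ℤ + y  ≡⟨ cong (λ z → + d *ℤ z - δ k d *ℤ + y) (pos-affine x d y) ⟨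
      + d *ℤ + (x + d * y) - δ k d *ℤ + y        ≡⟨ cong (λ z → + d *ℤ + z - δ k d *ℤ + y) x+dy≡ta ⟩
      + d *ℤ + (t * a) - δ k d *ℤ + y            ∎
      where
      expand : ∀ D X K Y → D *ℤ X +ℤ K *ℤ Y ≡ D *ℤ (X +ℤ D *ℤ Y) - (D *ℤ D - K) *ℤ Y
      expand = ℤ-Ring.solve-∀

    a∣dx+ky : a ∣ d * x + k * y
    a∣dx+ky = ℤ∣.∣⇒∣ᵤ {+ a} {+ (d * x + k * y)} (subst (+ a ℤ∣.∣_) (sym dx+ky≡) (ℤ∣.∣m∣n⇒∣m-n a∣dta a∣δy))
      where
      a∣dta = ℤ∣.∣n⇒∣m*n (+ d) (ℤ∣.∣ᵤ⇒∣ {+ a} {+ (t * a)} (n∣m*n t))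
      a∣δy  = ℤ∣.∣m⇒∣m*n (+ y) (ℤ∣.∣-trans (ℤ∣.∣ᵤ⇒∣ {+ a} {+ (a * b)} (m∣m*n b)) ab∣δ)

    x′ = quotient a∣dx+ky
    dx+ky≡x′a : d * x + k * y ≡ x′ * a
    dx+ky≡x′a = m∣n⇒n≡quotient*m a∣dx+ky

    fPair≡ : fPair k d (x , y) ≡ (a * x′ , a * t)
    fPair≡ = cong₂ _,_ (trans dx+ky≡x′a (*-comm x′ a)) (trans x+dy≡ta (*-comm t a))

    t≥1 : 1 ≤ t
    t≥1 = *-pos⇒posˡ (subst (1 ≤_) x+dy≡ta (≤-trans x≥1 (m≤m+n x (d * y))))

    x′≥1 : 1 ≤ x′
    x′≥1 = *-pos⇒posˡ (subst (1 ≤_) dx+ky≡x′a (≤-trans (*-mono-≤ k≥1 y≥1) (m≤n+m (k * y) (d * x))))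

    norm≡n′ : norm k (x′ , t) ≡ n′
    norm≡n′ = ℤₚ.*-cancelˡ-≡ (+ (a * a)) (norm k (x′ , t)) n′ (begin
      + (a * a) *ℤ norm k (x′ , t) ≡⟨ norm-scale k a x′ t ⟨
      norm k (a * x′ , a * t)      ≡⟨ cong (norm k) fPair≡ ⟨
      norm k (fPair k d (x , y))   ≡⟨ norm-fPair k d (x , y) ⟩
      δ k d *ℤ norm k (x , y)      ≡⟨ cong (δ k d *ℤ_) norm≡n ⟩
      δ k d *ℤ n                   ≡⟨ a²n′≡δn ⟨
      + (a * a) *ℤ n′              ∎)

    a[x′+dt]≡ : + (a * (x′ + d * t)) ≡ + (2 * d * (t * a)) - δ k d *ℤ + y
    a[x′+dt]≡ = begin
      + (a * (x′ + d * t))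
        ≡⟨ cong +_ (trans (distrib a x′ d t) (cong (_+ d * (t * a)) (sym dx+ky≡x′a))) ⟩
      + (d * x + k * y + d * (t * a))
        ≡⟨ ℤₚ.pos-+ (d * x + k * y) (d * (t * a)) ⟩
      + (d * x + k * y) +ℤ + (d * (t * a))
        ≡⟨ cong₂ _+ℤ_ dx+ky≡ (ℤₚ.pos-* d (t * a)) ⟩
      (+ d *ℤ + (t * a) - δ k d *ℤ + y) +ℤ + d *ℤ + (t * a)
        ≡⟨ twice (+ d) (+ (t * a)) (δ k d) (+ y) ⟩
      + 2 *ℤ + d *ℤ + (t * a) - δ k d *ℤ + y
        ≡⟨ cong (λ z → z - δ k d *ℤ + y) pos-2dta ⟨
      + (2 * d * (t * a)) - δ k d *ℤ + y ∎
      where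
      distrib : ∀ a x′ d t → a * (x′ + d * t) ≡ x′ * a + d * (t * a)
      distrib = solve-∀
      pos-2dta : + (2 * d * (t * a)) ≡ + 2 *ℤ + d *ℤ + (t * a)
      pos-2dta = trans (ℤₚ.pos-* (2 * d) (t * a)) (cong (_*ℤ + (t * a)) (ℤₚ.pos-* 2 d))
      twice : ∀ D T Δ Y → (D *ℤ T - Δ *ℤ Y) +ℤ D *ℤ T ≡ + 2 *ℤ D *ℤ T - Δ *ℤ Y
      twice = ℤ-Ring.solve-∀

    b∣x′+dt : b ∣ x′ + d * t
    b∣x′+dt = *-cancelˡ-∣ a (ℤ∣.∣⇒∣ᵤ {+ (a * b)} {+ (a * (x′ + d * t))}
      (subst (+ (a * b) ℤ∣.∣_) (sym a[x′+dt]≡) (ℤ∣.∣m∣n⇒∣m-n ab∣2dta (ℤ∣.∣m⇒∣m*n (+ y) ab∣δ))))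
      where
      ab∣2dta = ℤ∣.∣ᵤ⇒∣ {+ (a * b)} {+ (2 * d * (t * a))}
                  (subst (_∣ 2 * d * (t * a)) (*-comm b a) (*-pres-∣ b∣2d (n∣m*n t)))

module Orbit {k d α β : ℕ} (k≥1 : 1 ≤ k) (d≥1 : 1 ≤ d) (α≥1 : 1 ≤ α) (β≥1 : 1 ≤ β)
             (∣δ∣≡αβ : abs (δ k d) ≡ α * β) (α∣2d : α ∣ 2 * d) (β∣2d : β ∣ 2 * d) where

  iter-step : ∀ {n a v w} → 1 ≤ proj₁ v → iter k d n ≈P v → fPair k d v ≡ (a * proj₁ w , a * proj₂ w) →
    iter k d (suc n) ≈P w
  iter-step {n} {a} {x , y} {w} x≥1 iter≈v fv≡aw =
    ≈P-trans {iter k d (suc n)} {fPair k d (x , y)} {w} (≤-trans x≥1 (m≤m+n x (d * y)))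
             (fPair-cong k d iter≈v) (subst (_≈P w) (sym fv≡aw) (≈P-scale a))

  α²β²≡δ² : + (α * α) *ℤ + (β * β) ≡ δ k d *ℤ δ k d
  α²β²≡δ² = begin
    + (α * α) *ℤ + (β * β)            ≡⟨ ℤₚ.pos-* (α * α) (β * β) ⟨
    + ((α * α) * (β * β))             ≡⟨ cong +_ (square-* α β) ⟨
    + ((α * β) * (α * β))             ≡⟨ cong (λ z → + (z * z)) ∣δ∣≡αβ ⟨
    + (abs (δ k d) * abs (δ k d))     ≡⟨ square-abs (δ k d) ⟨
    δ k d *ℤ δ k d                    ∎
    where open ≡-Reasoning

  -- δ² = α²β²: dividing by α turns norm δ into β², dividing by β turns β² back into δ
  orbit : ∀ n → ∃[ v ] (iter k d (suc n) ≈P v × (OrbitPoint k d α (δ k d) v ⊎ OrbitPoint k d β (+ (β * β)) v))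
  orbit zero = (d , 1) , unit d k ,
    inj₁ (orbitPoint d≥1 ≤-refl (cong (+ d *ℤ + d -_) (ℤₚ.*-identityʳ (+ k))) (subst (α ∣_) (two d) α∣2d))
    where
    unit : ∀ d k → (d * 1 + k * 0) * 1 ≡ d * (1 + d * 0)
    unit = solve-∀
    two : ∀ d → 2 * d ≡ d + d * 1
    two = solve-∀
  orbit (suc n) with orbit n
  ... | v , iter≈v , inj₁ X =
    let (w , fv≡αw , Y) = orbit-step k≥1 α≥1 ∣δ∣≡αβ β∣2d α²β²≡δ² X
    in w , iter-step {suc n} {α} {v} {w} (OrbitPoint.num≥1 X) iter≈v fv≡αw , inj₂ Y
  ... | v , iter≈v , inj₂ Y =
    let (w , fv≡βw , X) = orbit-step k≥1 β≥1 (trans ∣δ∣≡αβ (*-comm α β)) α∣2d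
                                      (ℤₚ.*-comm (+ (β * β)) (δ k d)) Y
    in w , iter-step {suc n} {β} {v} {w} (OrbitPoint.num≥1 Y) iter≈v fv≡βw , inj₁ X

-- d is ⌊√k⌋ or ⌈√k⌉; the points of norm δ = d² − k are then close to √k
record NearestRoot (k d : ℕ) : Set where
  field
    d≥1     : 1 ≤ d
    ∣δ∣≥1   : 1 ≤ abs (δ k d)
    ∣δ∣≤2s  : abs (δ k d) ≤ 2 * fsqrt k
    δ-close : ∀ {x y} → 1 ≤ y → norm k (x , y) ≡ δ k d → Close k (fsqrt k) x y

module _ {k : ℕ} (k≥1 : 1 ≤ k) (non-square : ∀ m → ¬ (m * m ≡ k)) where

  floor-nearest : ∀ {d} → d * d ≤ k → k < suc d * suc d → NearestRoot k d
  floor-nearest {zero}  _ k<1 = ⊥-elim (<⇒≱ k<1 k≥1)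
  floor-nearest {d@(suc _)} d²≤k k<[1+d]² = record
    { d≥1     = s≤s z≤n
    ; ∣δ∣≥1   = subst (1 ≤_) (sym ∣δ∣≡e) e≥1
    ; ∣δ∣≤2s  = subst (_≤ 2 * fsqrt k) (sym ∣δ∣≡e) e≤2s
    ; δ-close = λ {x} {y} → close {x} {y}
    }
    where
    e = k ∸ d * d
    d²+e≡k : d * d + e ≡ k
    d²+e≡k = m+[n∸m]≡n d²≤k
    δ≡-e : δ k d ≡ -ℤ + e
    δ≡-e = begin
      + d *ℤ + d - + k             ≡⟨ cong₂ (λ u v → u - + v) (ℤₚ.pos-* d d) d²+e≡k ⟨
      + (d * d) - + (d * d + e)    ≡⟨ cong (+ (d * d) -_) (ℤₚ.pos-+ (d * d) e) ⟩
      + (d * d) - (+ (d * d) +ℤ + e) ≡⟨ cancel (+ (d * d)) (+ e) ⟩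
      -ℤ + e                       ∎
      where
      open ≡-Reasoning
      cancel : ∀ a c → a - (a +ℤ c) ≡ -ℤ c
      cancel = ℤ-Ring.solve-∀
    ∣δ∣≡e : abs (δ k d) ≡ e
    ∣δ∣≡e = trans (cong abs δ≡-e) (ℤₚ.∣-i∣≡∣i∣ (+ e))
    e≥1 : 1 ≤ e
    e≥1 = n≢0⇒n>0 λ e≡0 →
      non-square d (trans (sym (+-identityʳ (d * d))) (trans (cong (_+_ (d * d)) (sym e≡0)) d²+e≡k))
    e≤2d : e ≤ 2 * d
    e≤2d = ≤-pred (+-cancelˡ-< (d * d) e (suc (2 * d)) (subst₂ _<_ (sym d²+e≡k) (square-suc d) k<[1+d]²))
      where
      square-suc : ∀ d → suc d * suc d ≡ d * d + suc (2 * d)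
      square-suc = solve-∀
    e≤2s : e ≤ 2 * fsqrt k
    e≤2s = ≤-trans e≤2d (*-monoʳ-≤ 2 (fsqrt-greatest {k} {d} d²≤k))
    -- from x² + e = k y² = (d y)² + e y² ≥ (d y)² + e we get d y ≤ x, so e y ≤ 2 d y ≤ 2 x
    close : ∀ {x y} → 1 ≤ y → norm k (x , y) ≡ δ k d → Close k (fsqrt k) x y
    close {x} {y} y≥1 norm≡δ = inj₁ (e , ky²≡x²+e , ey≤2x)
      where
      ky²≡x²+e : k * (y * y) ≡ x * x + e
      ky²≡x²+e = norm≡neg⇒ k x y (trans norm≡δ δ≡-e)
      dy≤x : d * y ≤ x
      dy≤x = m*m≤n*n⇒m≤n {d * y} {x} (+-cancelʳ-≤ e _ _ (begin
        (d * y) * (d * y) + e           ≤⟨ +-monoʳ-≤ ((d * y) * (d * y)) (m≤m*n e (y * y)) ⟩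
        (d * y) * (d * y) + e * (y * y) ≡⟨ expand d y e ⟩
        (d * d + e) * (y * y)           ≡⟨ cong (_* (y * y)) d²+e≡k ⟩
        k * (y * y)                     ≡⟨ ky²≡x²+e ⟩
        x * x + e                       ∎))
        where
        open ≤-Reasoning
        instance _ = >-nonZero (*-mono-≤ y≥1 y≥1)
        expand : ∀ d y e → (d * y) * (d * y) + e * (y * y) ≡ (d * d + e) * (y * y)
        expand = solve-∀
      ey≤2x : e * y ≤ 2 * x
      ey≤2x = ≤-trans (*-monoˡ-≤ y e≤2d) (subst (_≤ 2 * x) (sym (*-assoc 2 d y)) (*-monoʳ-≤ 2 dy≤x))

  ceil-nearest : ∀ {d} → (d ∸ 1) * (d ∸ 1) < k → k ≤ d * d → NearestRoot k d
  ceil-nearest {zero}  _ k≤0 = ⊥-elim (<⇒≱ k≥1 k≤0)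
  ceil-nearest {suc d′} d′²<k k≤d² = record
    { d≥1     = s≤s z≤n
    ; ∣δ∣≥1   = subst (1 ≤_) (sym ∣δ∣≡e) e≥1
    ; ∣δ∣≤2s  = subst (_≤ 2 * fsqrt k) (sym ∣δ∣≡e) e≤2s
    ; δ-close = λ {x} {y} _ norm≡δ → inj₂ (e , norm≡pos⇒ k x y (trans norm≡δ δ≡e) , e≤2s)
    }
    where
    d = suc d′
    e = d * d ∸ k
    k+e≡d² : k + e ≡ d * d
    k+e≡d² = m+[n∸m]≡n k≤d²
    δ≡e : δ k d ≡ + e
    δ≡e = begin
      + d *ℤ + d - + k       ≡⟨ cong (λ u → u - + k) (ℤₚ.pos-* d d) ⟨
      + (d * d) - + k        ≡⟨ cong (λ u → + u - + k) k+e≡d² ⟨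
      + (k + e) - + k        ≡⟨ cong (_- + k) (ℤₚ.pos-+ k e) ⟩
      (+ k +ℤ + e) - + k     ≡⟨ cancel (+ k) (+ e) ⟩
      + e                    ∎
      where
      open ≡-Reasoning
      cancel : ∀ a c → (a +ℤ c) - a ≡ c
      cancel = ℤ-Ring.solve-∀
    ∣δ∣≡e : abs (δ k d) ≡ e
    ∣δ∣≡e = cong abs δ≡e
    e≥1 : 1 ≤ e
    e≥1 = n≢0⇒n>0 λ e≡0 →
      non-square d (sym (trans (sym (+-identityʳ k)) (trans (cong (_+_ k) (sym e≡0)) k+e≡d²)))
    e≤2s : e ≤ 2 * fsqrt k
    e≤2s = ≤-trans e≤2d′ (*-monoʳ-≤ 2 (fsqrt-greatest {k} {d′} (<⇒≤ d′²<k)))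
      where
      square-suc : ∀ d′ → suc d′ * suc d′ ≡ d′ * d′ + suc (2 * d′)
      square-suc = solve-∀
      e≤2d′ : e ≤ 2 * d′
      e≤2d′ = ≤-pred (+-cancelˡ-< (d′ * d′) e (suc (2 * d′))
                (<-≤-trans (+-monoˡ-< e d′²<k) (≤-reflexive (trans k+e≡d² (square-suc d′)))))

δ∣[2d]² : ∀ {k d} → ∃[ R ] (R *ℤ (+ k - + (d * d)) ≡ + (4 * (d * d))) → abs (δ k d) ∣ 2 * d * (2 * d)
δ∣[2d]² {k} {d} (R , R[k-d²]≡4d²) =
  subst₂ _∣_ ∣k-d²∣≡∣δ∣ (four d)
    (ℤ∣.∣⇒∣ᵤ {+ k - + (d * d)} {+ (4 * (d * d))} (ℤ∣.divides R (sym R[k-d²]≡4d²)))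
  where
  four : ∀ d → 4 * (d * d) ≡ 2 * d * (2 * d)
  four = solve-∀
  flip : ∀ a b → a - b ≡ -ℤ (b - a)
  flip = ℤ-Ring.solve-∀
  ∣k-d²∣≡∣δ∣ : abs (+ k - + (d * d)) ≡ abs (δ k d)
  ∣k-d²∣≡∣δ∣ = trans (cong (λ u → abs (+ k - u)) (ℤₚ.pos-* d d))
                     (trans (cong abs (flip (+ k) (+ d *ℤ + d))) (ℤₚ.∣-i∣≡∣i∣ (δ k d)))

iterates-close : ∀ {k d} → 1 ≤ k → NearestRoot k d →
  ∃[ R ] (R *ℤ (+ k - + (d * d)) ≡ + (4 * (d * d))) →
  ∀ n → ∃[ v ] (iter k d (suc n) ≈P v × 1 ≤ proj₁ v × 1 ≤ proj₂ v × Close k (fsqrt k) (proj₁ v) (proj₂ v))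
iterates-close {k} {d} k≥1 nearest R-hyp n
  with square-divisor-split (NearestRoot.∣δ∣≥1 nearest) (δ∣[2d]² {k} {d} R-hyp)
... | α , β , αβ≡∣δ∣ , α∣2d , β∣2d , β≤α , α≥1 , β≥1
  with Orbit.orbit {k} {d} {α} {β} k≥1 (NearestRoot.d≥1 nearest) α≥1 β≥1 (sym αβ≡∣δ∣) α∣2d β∣2d n
...   | (x , y) , iter≈v , inj₁ (orbitPoint x≥1 y≥1 norm≡δ _) =
  (x , y) , iter≈v , x≥1 , y≥1 , NearestRoot.δ-close nearest {x} {y} y≥1 norm≡δ
...   | (x , y) , iter≈v , inj₂ (orbitPoint x≥1 y≥1 norm≡β² _) =
  (x , y) , iter≈v , x≥1 , y≥1 , inj₂ (β * β , norm≡pos⇒ k x y norm≡β² , β²≤2s)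
  where
  β²≤2s : β * β ≤ 2 * fsqrt k
  β²≤2s = ≤-trans (*-monoˡ-≤ β β≤α) (subst (_≤ 2 * fsqrt k) (sym αβ≡∣δ∣) (NearestRoot.∣δ∣≤2s nearest))

theorem2p6 : (k d : ℕ) → 1 ≤ k → (∀ m → ¬ (m * m ≡ k))
    → ((d * d ≤ k × k < suc d * suc d) ⊎ ((d ∸ 1) * (d ∸ 1) < k × k ≤ d * d))
    → ∃[ R ] (R Data.Integer.* (+ k - + (d * d)) ≡ + (4 * (d * d)))
    → ∀ n → 1 ≤ n
    → ∃[ r ] ∃[ b ] (b ≤ cf k r × iter k d n ≈P cfValue (semiconvList k r b))
theorem2p6 k d k≥1 non-square bracket R-hyp (suc n) _ =
  let (v , iter≈v , x≥1 , y≥1 , close) = iterates-close k≥1 nearest R-hyp n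
      (r , b , b≤c , v≈semiconvergent) = Descent.close⇒semiconvergent k≥1 non-square y≥1 close x≥1
  in r , b , b≤c , ≈P-trans {iter k d (suc n)} {v} {cfValue (semiconvList k r b)} y≥1 iter≈v
                            v≈semiconvergent
  where
  nearest : NearestRoot k d
  nearest = [ (λ (d²≤k , k<[1+d]²) → floor-nearest k≥1 non-square d²≤k k<[1+d]²)
            , (λ ([d-1]²<k , k≤d²) → ceil-nearest k≥1 non-square [d-1]²<k k≤d²) ]′ bracket
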